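{- A finite graph is lefthanded with respect to some tree order on its vertex set if and only if it is isomorphic to a subtree graph.
   Context: A tree order is a partial order $\leq$ in which $w\lneq u$ and $w\lneq v$ imply that $u$ and $v$ are comparable. A graph $G$ is lefthanded with respect to a tree order $\leq$ on $V(G)$ if (1) $u\sim v$ implies $u\leq v$ or $v\leq u$, and (2) whenever $w\lneq u\lneq v$ and $v\sim w$, also $v\sim u$. A subtree graph is a graph whose vertex set is a set of subtrees of some fixed finite tree, where two vertices are adjacent exactly when the corresponding subtrees intersect. -}

module Defs where

open import Level using (0ℓ)
open import Data.Nat using (ℕ; suc; _≤_)
open import Data.Fin using (Fin)
open import Data.Fin.Subset using (Subset; _∈_; _∩_; Nonempty; ⊤)
open import Data.List using (List; []; _∷_; _++_; [_])
open import Data.List.Relation.Unary.Linked using (Linked)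
open import Data.List.Relation.Unary.Unique.Propositional using (Unique)
open import Data.Sum using (_⊎_)
open import Data.Product using (Σ; ∃; _×_; _,_)
open import Relation.Nullary using (¬_)
open import Relation.Binary using (Rel; Decidable; IsPartialOrder; Symmetric; Irreflexive)
open import Relation.Binary.PropositionalEquality using (_≡_; _≢_)
open import Function using (_⇔_)
open import Function.Definitions using (Injective)

record SimpleGraph (n : ℕ) : Set₁ where
  field
    Adj    : Rel (Fin n) 0ℓ
    sym    : Symmetric Adj
    irrefl : Irreflexive _≡_ Adj
    dec    : Decidable Adj
open SimpleGraph public

module _ {m : ℕ} (G : SimpleGraph m) where

  data WalkIn (S : Subset m) : Fin m → Fin m → Set where
    here : ∀ {x} → x ∈ S → WalkIn S x x
    step : ∀ {x z y} → x ∈ S → Adj G x z → WalkIn S z y → WalkIn S x y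

  ConnectedSet : Subset m → Set
  ConnectedSet S = ∀ x y → x ∈ S → y ∈ S → WalkIn S x y

  Connected : Set
  Connected = ∀ x y → WalkIn ⊤ x y

  HasCycle : Set
  HasCycle = Σ (Fin m) λ v0 → Σ (Fin m) λ v1 → Σ (Fin m) λ v2 → Σ (List (Fin m)) λ rest →
    Unique (v0 ∷ v1 ∷ v2 ∷ rest) × Linked (Adj G) (v0 ∷ v1 ∷ v2 ∷ rest ++ [ v0 ])

  IsTree : Set
  IsTree = (1 ≤ m) × Connected × ¬ HasCycle

  IsSubtree : Subset m → Set
  IsSubtree S = Nonempty S × ConnectedSet S

record TreeOrder (n : ℕ) : Set₁ where
  field
    _≤ₜ_         : Rel (Fin n) 0ℓ
    isPartialOrder : IsPartialOrder _≡_ _≤ₜ_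
    dec          : Decidable _≤ₜ_
    tree         : ∀ {w u v} → w ≤ₜ u → w ≢ u → w ≤ₜ v → w ≢ v →
                   (u ≤ₜ v) ⊎ (v ≤ₜ u)
open TreeOrder public

_<[_]_ : ∀ {n} → Fin n → TreeOrder n → Fin n → Set
w <[ T ] u = (_≤ₜ_ T w u) × (w ≢ u)

Lefthanded : ∀ {n} → SimpleGraph n → TreeOrder n → Set
Lefthanded G T =
  (∀ u v → Adj G u v → (_≤ₜ_ T u v) ⊎ (_≤ₜ_ T v u)) ×
  (∀ w u v → w <[ T ] u → u <[ T ] v → Adj G v w → Adj G v u)

-- G is isomorphic to a subtree graph: there are a finite tree T and an
-- injective assignment of subtrees of T to the vertices of G (so the vertex
-- set of the subtree graph is the image, a set of subtrees) such that distinct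
-- vertices are adjacent exactly when their subtrees intersect.
IsoToSubtreeGraph : ∀ {n} → SimpleGraph n → Set₁
IsoToSubtreeGraph {n} G =
  Σ ℕ λ m → Σ (SimpleGraph m) λ T → IsTree T ×
  Σ (Fin n → Subset m) λ f →
    (∀ i → IsSubtree T (f i)) ×
    Injective _≡_ _≡_ f ×
    (∀ u v → u ≢ v → (Adj G u v ⇔ Nonempty (f u ∩ f v)))

module Submission where

-- (⇒) Given a tree order ≤ for which G is lefthanded, the host tree has the
--     vertices of G plus a new root; every vertex is joined to the element
--     covering it in ≤ (or to the root if it is maximal).  This graph of a
--     "parent" function is a tree.  Vertex v is sent to the subtree
--     {v} ∪ {x < v : x ∼ v}; it is connected because lefthandedness propagates
--     adjacency to v along covers, and two such subtrees meet exactly when the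
--     vertices are adjacent.
-- (⇐) Root the host tree anywhere and let "a is an ancestor of x" mean that a
--     lies on every walk from x to the root.  Every subtree S has a top
--     vertex, an ancestor of all of S, and S is convex below its top.  Order
--     the vertices of G by the ancestor order of their tops, breaking ties by
--     index; this is a tree order and G is lefthanded for it.

open import Defs hiding (sym)
open import Data.Nat as ℕ using (ℕ; zero; suc; z≤n; s≤s)
import Data.Nat.Properties as ℕP
open import Data.Fin as F using (Fin; zero; suc)
open import Data.Fin.Properties as FP using (any?; all?; pigeonhole)
open import Data.Fin.Induction using (po-wellFounded; po-noetherian)
open import Data.Fin.Subset using (Subset; _∈_; _∩_; Nonempty; ⊤)
open import Data.Fin.Subset.Properties using (∈⊤; x∈p∩q⁺; x∈p∩q⁻; drop-there; _∈?_)
open import Data.Bool using (false)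
import Data.Vec as Vec
open import Data.Vec.Properties using (lookup∘tabulate; []=⇒lookup; lookup⇒[]=)
open import Data.List using (List; []; _∷_; _++_; [_]; length; lookup)
open import Data.List.Relation.Unary.Linked as Linked using (Linked; []; [-]; _∷_)
open import Data.List.Relation.Unary.All as All using (All; []; _∷_)
open import Data.List.Relation.Unary.AllPairs as AllPairs using (AllPairs; []; _∷_)
import Data.List.Relation.Unary.Any as Any
open import Data.List.Relation.Unary.Unique.Propositional using (Unique)
open import Data.List.Membership.Propositional using () renaming (_∈_ to _∈ˡ_)
open import Data.List.Membership.Propositional.Properties using (∈-lookup)
import Data.List.Membership.DecPropositional as DecMembership
open import Data.Sum using (_⊎_; inj₁; inj₂)
open import Data.Product using (Σ; ∃; _×_; _,_; proj₁; proj₂)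
open import Data.Empty using (⊥; ⊥-elim)
open import Data.Unit using (tt) renaming (⊤ to Unit)
open import Relation.Nullary using (¬_; Dec; yes; no)
open import Relation.Nullary.Decidable using (_×-dec_; _⊎-dec_; ¬?; does; dec-true)
open import Relation.Binary using (IsPartialOrder; Symmetric; tri<; tri≈; tri>)
open import Relation.Binary.Definitions using (DecidableEquality)
open import Relation.Binary.PropositionalEquality
  using (_≡_; _≢_; refl; sym; trans; cong; subst; isEquivalence; ≢-sym)
open import Induction.WellFounded using (Acc; acc)
open import Function using (flip)
open import Function.Bundles using (mk⇔; _⇔_; Equivalence)
open import Function.Definitions using (Injective)

-- Walks in a relation R through vertices satisfying P, as an inductive family
-- over an arbitrary type; WalkIn of Defs is the instance for graphs on Fin m.
module Walks {A : Set} where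

  data Walk (P : A → Set) (R : A → A → Set) : A → A → Set where
    here : ∀ {x} → P x → Walk P R x x
    step : ∀ {x z y} → P x → R x z → Walk P R z y → Walk P R x y

  module _ {P : A → Set} {R : A → A → Set} where

    start∈ : ∀ {x y} → Walk P R x y → P x
    start∈ (here p)     = p
    start∈ (step p _ _) = p

    end∈ : ∀ {x y} → Walk P R x y → P y
    end∈ (here p)     = p
    end∈ (step _ _ w) = end∈ w

    _++ʷ_ : ∀ {x y z} → Walk P R x y → Walk P R y z → Walk P R x z
    here _     ++ʷ w′ = w′
    step p r w ++ʷ w′ = step p r (w ++ʷ w′)

    reverseʷ : Symmetric R → ∀ {x y} → Walk P R x y → Walk P R y x
    reverseʷ sym-R w = go w (here (start∈ w))
      where
      go : ∀ {x y z} → Walk P R x y → Walk P R x z → Walk P R y z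
      go (here _)     w′ = w′
      go (step p r w) w′ = go w (step (start∈ w) (sym-R r) w′)

  mapʷ : ∀ {P Q : A → Set} {R S : A → A → Set} →
         (∀ {x} → P x → Q x) → (∀ {x y} → P x → P y → R x y → S x y) →
         ∀ {x y} → Walk P R x y → Walk Q S x y
  mapʷ f g (here p)     = here (f p)
  mapʷ f g (step p r w) = step (f p) (g p (start∈ w) r) (mapʷ f g w)

  weakenʷ : ∀ {P Q : A → Set} {R : A → A → Set} → (∀ {x} → P x → Q x) →
            ∀ {x y} → Walk P R x y → Walk Q R x y
  weakenʷ f = mapʷ f (λ _ _ r → r)

  module _ {P Q : A → Set} {R : A → A → Set} (Q? : ∀ x → Dec (Q x)) where

    firstVisit : ∀ {x y} → Walk P R x y →
      Walk (λ z → P z × ¬ Q z) R x y ⊎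
      Σ A (λ t → Q t × Walk (λ z → P z × (Q z → z ≡ t)) R x t)
    firstVisit {x} (here p) with Q? x
    ... | yes q  = inj₂ (x , q , here (p , λ _ → refl))
    ... | no ¬q  = inj₁ (here (p , ¬q))
    firstVisit {x} (step p r w) with Q? x
    ... | yes q  = inj₂ (x , q , here (p , λ _ → refl))
    ... | no ¬q with firstVisit w
    ...   | inj₁ w′            = inj₁ (step (p , ¬q) r w′)
    ...   | inj₂ (t , qt , w′) = inj₂ (t , qt , step (p , λ q → ⊥-elim (¬q q)) r w′)

    -- after its last visit t of Q, a walk ends at t or leaves Q for good
    Exit : A → A → Set
    Exit t y = t ≡ y ⊎ Σ A (λ t′ → R t t′ × Walk (λ z → P z × ¬ Q z) R t′ y)

    lastVisit : ∀ {x y} → Walk P R x y →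
      Walk (λ z → P z × ¬ Q z) R x y ⊎ Σ A (λ t → Q t × P t × Exit t y)
    lastVisit {x} (here p) with Q? x
    ... | yes q = inj₂ (x , q , p , inj₁ refl)
    ... | no ¬q = inj₁ (here (p , ¬q))
    lastVisit {x} (step {z = z} p r w) with lastVisit w
    ... | inj₂ e  = inj₂ e
    ... | inj₁ w′ with Q? x
    ...   | yes q = inj₂ (x , q , p , inj₂ (z , r , w′))
    ...   | no ¬q = inj₁ (step (p , ¬q) r w′)

open Walks

toWalkIn : ∀ {m} {G : SimpleGraph m} {S : Subset m} {x y} →
           Walk (_∈ S) (Adj G) x y → WalkIn G S x y
toWalkIn (here p)     = WalkIn.here p
toWalkIn (step p r w) = WalkIn.step p r (toWalkIn w)

fromWalkIn : ∀ {m} {G : SimpleGraph m} {S : Subset m} {x y} →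
             WalkIn G S x y → Walk (_∈ S) (Adj G) x y
fromWalkIn (WalkIn.here p)     = here p
fromWalkIn (WalkIn.step p r w) = step p r (fromWalkIn w)

lastOf : ∀ {A : Set} → A → List A → A
lastOf x []       = x
lastOf x (y ∷ ys) = lastOf y ys

lastOf-snoc : ∀ {A : Set} (y : A) ys e → lastOf y (ys ++ [ e ]) ≡ e
lastOf-snoc y []       e = refl
lastOf-snoc y (z ∷ zs) e = lastOf-snoc z zs e

lastOf∈ : ∀ {A : Set} (y : A) ys → lastOf y ys ∈ˡ (y ∷ ys)
lastOf∈ y []       = Any.here refl
lastOf∈ y (z ∷ zs) = Any.there (lastOf∈ z zs)

linked-snoc : ∀ {A : Set} {R : A → A → Set} x ys e →
              Linked R (x ∷ ys) → R (lastOf x ys) e → Linked R (x ∷ ys ++ [ e ])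
linked-snoc x []       e _        r′ = r′ ∷ [-]
linked-snoc x (y ∷ ys) e (r ∷ lk) r′ = r ∷ linked-snoc y ys e lk r′

record Path {A : Set} (P : A → Set) (R : A → A → Set) (x y : A) : Set where
  constructor mkPath
  field
    xs      : List A
    linked  : Linked R (x ∷ xs)
    unique  : Unique (x ∷ xs)
    all     : All P (x ∷ xs)
    ends-at : lastOf x xs ≡ y

module LoopErasure {A : Set} (_≟_ : DecidableEquality A) {P : A → Set} {R : A → A → Set} where
  open DecMembership _≟_ using () renaming (_∈?_ to _∈ˡ?_)

  suffixFrom : ∀ x y ys → x ∈ˡ (y ∷ ys) → Linked R (y ∷ ys) → Unique (y ∷ ys) → All P (y ∷ ys) →
               Σ (List A) λ suf → Linked R (x ∷ suf) × Unique (x ∷ suf) × All P (x ∷ suf) ×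
                                   lastOf x suf ≡ lastOf y ys
  suffixFrom x y ys       (Any.here refl) lk un al = ys , lk , un , al , refl
  suffixFrom x y (z ∷ zs) (Any.there x∈)  lk un al =
    suffixFrom x z zs x∈ (Linked.tail lk) (AllPairs.tail un) (All.tail al)

  toPath : ∀ {x y} → Walk P R x y → Path P R x y
  toPath (here p) = mkPath [] [-] ([] ∷ []) (p ∷ []) refl
  toPath {x} (step {z = z} p r w) with toPath w
  ... | mkPath zs lk un al end with x ∈ˡ? (z ∷ zs)
  ...   | yes x∈ with suffixFrom x z zs x∈ lk un al
  ...     | suf , lk′ , un′ , al′ , end′ = mkPath suf lk′ un′ al′ (trans end′ end)
  toPath {x} (step {z = z} p r w) | mkPath zs lk un al end | no x∉ =
    mkPath (z ∷ zs) (r ∷ lk) (All.tabulate (λ w∈ eq → x∉ (subst (_∈ˡ (z ∷ zs)) (sym eq) w∈)) ∷ un)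
           (p ∷ al) end

-- On Fin m the existence of a walk is decidable: a shortest walk is a path,
-- so it has fewer than m steps, and walks of bounded length can be enumerated.
module DecidableWalks {m : ℕ} {P : Fin m → Set} {R : Fin m → Fin m → Set}
                      (P? : ∀ x → Dec (P x)) (R? : ∀ x y → Dec (R x y)) where
  open LoopErasure FP._≟_ {P} {R}

  unique⇒length≤ : ∀ (L : List (Fin m)) → Unique L → length L ℕ.≤ m
  unique⇒length≤ L un with length L ℕ.≤? m
  ... | yes ≤m = ≤m
  ... | no  ≰m with pigeonhole (ℕP.≰⇒> ≰m) (lookup L)
  ...   | i , j , i<j , eq = ⊥-elim (distinct L un i<j eq)
    where
    distinct : ∀ (L : List (Fin m)) → AllPairs _≢_ L → ∀ {i j} → i F.< j → lookup L i ≢ lookup L j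
    distinct (x ∷ xs) (x∉ ∷ _)  {zero}  {suc j} _       = All.lookup x∉ (∈-lookup j)
    distinct (x ∷ xs) (_ ∷ un) {suc i} {suc j} (s≤s p) = distinct xs un p

  ShortWalk : ℕ → Fin m → Fin m → Set
  ShortWalk zero    x y = P x × x ≡ y
  ShortWalk (suc k) x y = (P x × x ≡ y) ⊎ (P x × ∃ λ z → R x z × ShortWalk k z y)

  shortWalk? : ∀ k x y → Dec (ShortWalk k x y)
  shortWalk? zero    x y = P? x ×-dec (x FP.≟ y)
  shortWalk? (suc k) x y =
    (P? x ×-dec (x FP.≟ y)) ⊎-dec (P? x ×-dec any? (λ z → R? x z ×-dec shortWalk? k z y))

  shortWalk⇒walk : ∀ k {x y} → ShortWalk k x y → Walk P R x y
  shortWalk⇒walk zero    (p , refl)               = here p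
  shortWalk⇒walk (suc k) (inj₁ (p , refl))        = here p
  shortWalk⇒walk (suc k) (inj₂ (p , z , r , sw)) = step p r (shortWalk⇒walk k sw)

  shortWalk-mono : ∀ {k k′} → k ℕ.≤ k′ → ∀ {x y} → ShortWalk k x y → ShortWalk k′ x y
  shortWalk-mono {zero}  {zero}   _       sw = sw
  shortWalk-mono {zero}  {suc k′} _       sw = inj₁ sw
  shortWalk-mono {suc k} {suc k′} (s≤s _) (inj₁ sw) = inj₁ sw
  shortWalk-mono {suc k} {suc k′} (s≤s k≤k′) (inj₂ (p , z , r , sw)) =
    inj₂ (p , z , r , shortWalk-mono k≤k′ sw)

  path⇒shortWalk : ∀ x xs → Linked R (x ∷ xs) → All P (x ∷ xs) → ShortWalk (length xs) x (lastOf x xs)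
  path⇒shortWalk x []       _        (p ∷ _)  = p , refl
  path⇒shortWalk x (y ∷ ys) (r ∷ lk) (p ∷ al) = inj₂ (p , y , r , path⇒shortWalk y ys lk al)

  walk? : ∀ x y → Dec (Walk P R x y)
  walk? x y with shortWalk? m x y
  ... | yes sw = yes (shortWalk⇒walk m sw)
  ... | no ¬sw = no λ w → ¬sw (viaPath (toPath w))
    where
    viaPath : Path P R x y → ShortWalk m x y
    viaPath (mkPath xs lk un al end) =
      subst (ShortWalk m x) end
        (shortWalk-mono (ℕP.≤-trans (ℕP.n≤1+n _) (unique⇒length≤ (x ∷ xs) un)) (path⇒shortWalk x xs lk al))

-- If each vertex has at most
-- one parent and the parent relation lies inside an irreflexive transitive
-- relation Above, this graph has no cycle: a cycle cannot backtrack, so it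
-- climbs, then (having passed its top) only descends, and must return to its
-- start through the start's parent, which it already left through.
module ParentGraph {A : Set} (Parent Above : A → A → Set)
    (parent⇒above : ∀ {x y} → Parent x y → Above x y)
    (above-trans  : ∀ {x y z} → Above x y → Above y z → Above x z)
    (above-irrefl : ∀ {x} → ¬ Above x x)
    (parent-unique : ∀ {x y z} → Parent x y → Parent x z → y ≡ z) where

  Edge : A → A → Set
  Edge x y = Parent x y ⊎ Parent y x

  NoBacktrack : List A → Set
  NoBacktrack (a ∷ b ∷ c ∷ xs) = a ≢ c × NoBacktrack (b ∷ c ∷ xs)
  NoBacktrack _                = Unit

  noBacktrack-snoc : ∀ (M : List A) e → AllPairs _≢_ M → All (_≢ e) M → NoBacktrack (M ++ [ e ])
  noBacktrack-snoc []                e _ _ = tt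
  noBacktrack-snoc (a ∷ [])          e _ _ = tt
  noBacktrack-snoc (a ∷ b ∷ [])      e _ (a≢e ∷ _) = a≢e , tt
  noBacktrack-snoc (a ∷ b ∷ c ∷ M) e ((_ ∷ a≢c ∷ _) ∷ un) (_ ∷ ≢e) =
    a≢c , noBacktrack-snoc (b ∷ c ∷ M) e un ≢e

  -- after a downward step a walk without backtracking keeps descending,
  -- since the only upward edge at a vertex leads back to its parent
  keepsDescending : ∀ x y zs → NoBacktrack (x ∷ y ∷ zs) → Linked Edge (x ∷ y ∷ zs) → Parent y x →
                    Linked (flip Parent) (x ∷ y ∷ zs)
  keepsDescending x y []       _          _            y↑x = y↑x ∷ [-]
  keepsDescending x y (z ∷ zs) (x≢z , nb) (_ ∷ e ∷ lk) y↑x with e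
  ... | inj₁ y↑z = ⊥-elim (x≢z (parent-unique y↑x y↑z))
  ... | inj₂ z↑y = y↑x ∷ keepsDescending y z zs nb (e ∷ lk) z↑y

  LastStepDown : A → List A → Set
  LastStepDown x []           = ⊥
  LastStepDown x (y ∷ [])     = Parent y x
  LastStepDown x (y ∷ z ∷ zs) = LastStepDown y (z ∷ zs)

  descent⇒lastStepDown : ∀ x y zs → Linked (flip Parent) (x ∷ y ∷ zs) → LastStepDown x (y ∷ zs)
  descent⇒lastStepDown x y []       (d ∷ _)  = d
  descent⇒lastStepDown x y (z ∷ zs) (_ ∷ lk) = descent⇒lastStepDown y z zs lk

  lastStepDown-snoc : ∀ x y ys e → LastStepDown x (y ∷ ys ++ [ e ]) → Parent e (lastOf y ys)
  lastStepDown-snoc x y []       e d = d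
  lastStepDown-snoc x y (z ∷ zs) e d = lastStepDown-snoc y z zs e d

  ascentOrLastStepDown : ∀ x y zs → NoBacktrack (x ∷ y ∷ zs) → Linked Edge (x ∷ y ∷ zs) → Parent x y →
                         Linked Parent (x ∷ y ∷ zs) ⊎ LastStepDown x (y ∷ zs)
  ascentOrLastStepDown x y []       _        _            x↑y = inj₁ (x↑y ∷ [-])
  ascentOrLastStepDown x y (z ∷ zs) (_ , nb) (_ ∷ e ∷ lk) x↑y with e
  ... | inj₂ z↑y = inj₂ (descent⇒lastStepDown y z zs (keepsDescending y z zs nb (e ∷ lk) z↑y))
  ... | inj₁ y↑z with ascentOrLastStepDown y z zs nb (e ∷ lk) y↑z
  ...   | inj₁ ascent = inj₁ (x↑y ∷ ascent)
  ...   | inj₂ down   = inj₂ down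

  ascent⇒above : ∀ x y zs → Linked Parent (x ∷ y ∷ zs) → Above x (lastOf y zs)
  ascent⇒above x y []       (p ∷ _)  = parent⇒above p
  ascent⇒above x y (z ∷ zs) (p ∷ lk) = above-trans (parent⇒above p) (ascent⇒above y z zs lk)

  descent⇒below : ∀ x y zs → Linked (flip Parent) (x ∷ y ∷ zs) → Above (lastOf y zs) x
  descent⇒below x y []       (p ∷ _)  = parent⇒above p
  descent⇒below x y (z ∷ zs) (p ∷ lk) = above-trans (descent⇒below y z zs lk) (parent⇒above p)

  noCycle : ∀ v0 v1 v2 rest → Unique (v0 ∷ v1 ∷ v2 ∷ rest) →
            ¬ Linked Edge (v0 ∷ v1 ∷ v2 ∷ rest ++ [ v0 ])
  noCycle v0 v1 v2 rest un lk@(e01 ∷ _) = firstStep e01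
    where
    noBacktrack : NoBacktrack (v0 ∷ v1 ∷ v2 ∷ rest ++ [ v0 ])
    noBacktrack = All.lookup (AllPairs.head un) (Any.there (Any.here refl)) ,
                  noBacktrack-snoc (v1 ∷ v2 ∷ rest) v0 (AllPairs.tail un)
                                   (All.map (λ v0≢ eq → v0≢ (sym eq)) (AllPairs.head un))
    closes : lastOf v1 (v2 ∷ rest ++ [ v0 ]) ≡ v0
    closes = lastOf-snoc v1 (v2 ∷ rest) v0
    firstStep : Edge v0 v1 → ⊥
    firstStep (inj₂ v1↑v0) =
      above-irrefl (subst (λ q → Above q v0) closes
                          (descent⇒below v0 v1 _ (keepsDescending v0 v1 _ noBacktrack lk v1↑v0)))
    firstStep (inj₁ v0↑v1) with ascentOrLastStepDown v0 v1 _ noBacktrack lk v0↑v1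
    ... | inj₁ ascent = above-irrefl (subst (Above v0) closes (ascent⇒above v0 v1 _ ascent))
    ... | inj₂ down   = All.lookup (AllPairs.head (AllPairs.tail un)) (lastOf∈ v2 rest)
                          (parent-unique v0↑v1 (lastStepDown-snoc v0 v1 (v2 ∷ rest) v0 down))

select : ∀ {k} {P : Fin k → Set} → (∀ x → Dec (P x)) → Subset k
select P? = Vec.tabulate (λ x → does (P? x))

∈select⁺ : ∀ {k} {P : Fin k → Set} (P? : ∀ x → Dec (P x)) {x} → P x → x ∈ select P?
∈select⁺ P? {x} p = lookup⇒[]= x _ (trans (lookup∘tabulate _ x) (dec-true (P? x) p))

∈select⁻ : ∀ {k} {P : Fin k → Set} (P? : ∀ x → Dec (P x)) {x} → x ∈ select P? → P x
∈select⁻ P? {x} x∈ with P? x | trans (sym (lookup∘tabulate (λ y → does (P? y)) x)) ([]=⇒lookup x∈)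
... | yes p | _  = p
... | no _  | ()

module FromTreeOrder {n : ℕ} (G : SimpleGraph n) (T : TreeOrder n) (lh : Lefthanded G T) where

  module ≤ = IsPartialOrder (isPartialOrder T)

  _≤_ : Fin n → Fin n → Set
  _≤_ = _≤ₜ_ T

  _<_ : Fin n → Fin n → Set
  x < y = x <[ T ] y

  _<?_ : ∀ x y → Dec (x < y)
  x <? y = dec T x y ×-dec ¬? (x FP.≟ y)

  <-trans : ∀ {x y z} → x < y → y < z → x < z
  <-trans (x≤y , x≢y) (y≤z , _) = ≤.trans x≤y y≤z , λ { refl → x≢y (≤.antisym x≤y y≤z) }

  adj-sym : ∀ {x y} → Adj G x y → Adj G y x
  adj-sym = SimpleGraph.sym G

  lefthanded : ∀ w u v → w < u → u < v → Adj G v w → Adj G v u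
  lefthanded = proj₂ lh

  Covers : Fin n → Fin n → Set
  Covers a b = a < b × (∀ z → ¬ (a < z × z < b))

  Maximal : Fin n → Set
  Maximal a = ∀ z → ¬ (a < z)

  coverBelow : ∀ {x y} → x < y → Σ (Fin n) λ c → Covers x c × c ≤ y
  coverBelow {x} {y} x<y = go y (po-wellFounded (isPartialOrder T) y) x<y
    where
    go : ∀ y → Acc _<_ y → x < y → Σ (Fin n) λ c → Covers x c × c ≤ y
    go y (acc below) x<y with any? (λ z → (x <? z) ×-dec (z <? y))
    ... | yes (z , x<z , z<y) with go z (below z<y) x<z
    ...   | c , cov , c≤z = c , cov , ≤.trans c≤z (proj₁ z<y)
    go y (acc below) x<y | no nothing-between = y , (x<y , λ z p → nothing-between (z , p)) , ≤.refl

  -- the elements above a form a chain, so a has at most one cover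
  cover-unique : ∀ {a b c} → Covers a b → Covers a c → b ≡ c
  cover-unique {a} {b} {c} (a<b , ¬below-b) (a<c , ¬below-c) with b FP.≟ c
  ... | yes b≡c = b≡c
  ... | no b≢c with tree T (proj₁ a<b) (proj₂ a<b) (proj₁ a<c) (proj₂ a<c)
  ...   | inj₁ b≤c = ⊥-elim (¬below-c b (a<b , (b≤c , b≢c)))
  ...   | inj₂ c≤b = ⊥-elim (¬below-b c (a<c , (c≤b , ≢-sym b≢c)))

  -- The host tree lives on Fin (suc n): zero is a new root and suc a stands
  -- for the vertex a.  The parent of a is its cover, or the root if a is maximal.
  Parent : Fin (suc n) → Fin (suc n) → Set
  Parent zero    _       = ⊥
  Parent (suc a) zero    = Maximal a
  Parent (suc a) (suc b) = Covers a b

  parent? : ∀ a b → Dec (Parent a b)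
  parent? zero    _       = no λ ()
  parent? (suc a) zero    = all? (λ z → ¬? (a <? z))
  parent? (suc a) (suc b) = (a <? b) ×-dec all? (λ z → ¬? ((a <? z) ×-dec (z <? b)))

  Above : Fin (suc n) → Fin (suc n) → Set
  Above zero    _       = ⊥
  Above (suc a) zero    = Unit
  Above (suc a) (suc b) = a < b

  parent⇒above : ∀ {a b} → Parent a b → Above a b
  parent⇒above {suc a} {zero}  _         = tt
  parent⇒above {suc a} {suc b} (a<b , _) = a<b

  above-trans : ∀ {a b c} → Above a b → Above b c → Above a c
  above-trans {suc a} {suc b} {zero}  _   _   = tt
  above-trans {suc a} {suc b} {suc c} a<b b<c = <-trans a<b b<c

  above-irrefl : ∀ {a} → ¬ Above a a
  above-irrefl {suc a} (_ , a≢a) = a≢a refl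

  parent-unique : ∀ {a b c} → Parent b a → Parent b c → a ≡ c
  parent-unique {zero}  {suc b} {zero}  _   _   = refl
  parent-unique {zero}  {suc b} {suc c} max cov = ⊥-elim (max c (proj₁ cov))
  parent-unique {suc a} {suc b} {zero}  cov max = ⊥-elim (max a (proj₁ cov))
  parent-unique {suc a} {suc b} {suc c} cov cov′ = cong suc (cover-unique cov cov′)

  open ParentGraph Parent Above parent⇒above above-trans above-irrefl parent-unique
    using (Edge; noCycle)

  Host : SimpleGraph (suc n)
  Host = record
    { Adj    = Edge
    ; sym    = λ { (inj₁ p) → inj₂ p ; (inj₂ p) → inj₁ p }
    ; irrefl = λ { refl (inj₁ p) → above-irrefl (parent⇒above p)
                 ; refl (inj₂ p) → above-irrefl (parent⇒above p) }
    ; dec    = λ a b → parent? a b ⊎-dec parent? b a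
    }

  climbToRoot : ∀ a → Acc (flip _<_) a → Walk (λ _ → Unit) Edge (suc a) zero
  climbToRoot a (acc above) with parent? (suc a) zero
  ... | yes max = step tt (inj₁ max) (here tt)
  ... | no ¬max with any? (a <?_)
  ...   | no nothing-above = ⊥-elim (¬max λ z a<z → nothing-above (z , a<z))
  ...   | yes (z , a<z) with coverBelow a<z
  ...     | c , cov , _ = step tt (inj₁ cov) (climbToRoot c (above (proj₁ cov)))

  toRoot : ∀ x → Walk (λ _ → Unit) Edge x zero
  toRoot zero    = here tt
  toRoot (suc a) = climbToRoot a (po-noetherian (isPartialOrder T) a)

  host-isTree : IsTree Host
  host-isTree = s≤s z≤n , connected , acyclic
    where
    connected : Connected Host
    connected x y = toWalkIn (weakenʷ (λ _ → ∈⊤) (toRoot x ++ʷ reverseʷ (SimpleGraph.sym Host) (toRoot y)))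
    acyclic : ¬ HasCycle Host
    acyclic (v0 , v1 , v2 , rest , un , lk) = noCycle v0 v1 v2 rest un lk

  InSubtree : Fin n → Fin n → Set
  InSubtree v x = x ≡ v ⊎ (x < v × Adj G x v)

  inSubtree? : ∀ v x → Dec (InSubtree v x)
  inSubtree? v x = (x FP.≟ v) ⊎-dec ((x <? v) ×-dec dec G x v)

  subtree : Fin n → Subset (suc n)
  subtree v = false Vec.∷ select (inSubtree? v)

  ∈subtree⁺ : ∀ {v x} → InSubtree v x → suc x ∈ subtree v
  ∈subtree⁺ {v} x∈ = Vec.there (∈select⁺ (inSubtree? v) x∈)

  ∈subtree⁻ : ∀ {v x} → suc x ∈ subtree v → InSubtree v x
  ∈subtree⁻ {v} x∈ = ∈select⁻ (inSubtree? v) (drop-there x∈)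

  root∉subtree : ∀ {v} → ¬ (zero ∈ subtree v)
  root∉subtree ()

  -- Lefthandedness at work: climbing from a lower neighbour x of v to its
  -- cover c ≤ v stays inside the subtree of v.
  cover∈subtree : ∀ {v x c} → x < v → Adj G x v → Covers x c → c ≤ v → InSubtree v c
  cover∈subtree {v} {x} {c} x<v x∼v (x<c , _) c≤v with c FP.≟ v
  ... | yes c≡v = inj₁ c≡v
  ... | no  c≢v = inj₂ ((c≤v , c≢v) , adj-sym (lefthanded x c v x<c (c≤v , c≢v) (adj-sym x∼v)))

  climbInSubtree : ∀ v x → Acc (flip _<_) x → InSubtree v x → Walk (_∈ subtree v) Edge (suc x) (suc v)
  climbInSubtree v x _ (inj₁ refl) = here (∈subtree⁺ (inj₁ refl))
  climbInSubtree v x (acc above) x∈@(inj₂ (x<v , x∼v)) with coverBelow x<v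
  ... | c , cov , c≤v =
    step (∈subtree⁺ x∈) (inj₁ cov) (climbInSubtree v c (above (proj₁ cov)) (cover∈subtree x<v x∼v cov c≤v))

  subtree-isSubtree : ∀ v → IsSubtree Host (subtree v)
  subtree-isSubtree v = (suc v , ∈subtree⁺ (inj₁ refl)) , connected
    where
    toTop : ∀ x → suc x ∈ subtree v → Walk (_∈ subtree v) Edge (suc x) (suc v)
    toTop x x∈ = climbInSubtree v x (po-noetherian (isPartialOrder T) x) (∈subtree⁻ x∈)
    connected : ConnectedSet Host (subtree v)
    connected zero    _       0∈ _  = ⊥-elim (root∉subtree 0∈)
    connected (suc x) zero    _  0∈ = ⊥-elim (root∉subtree 0∈)
    connected (suc x) (suc y) x∈ y∈ =
      toWalkIn (toTop x x∈ ++ʷ reverseʷ (SimpleGraph.sym Host) (toTop y y∈))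

  -- v is the top of its subtree, so the subtree determines v
  subtree-injective : Injective _≡_ _≡_ subtree
  subtree-injective {u} {v} eq with ∈subtree⁻ {v} {u} (subst (suc u ∈_) eq (∈subtree⁺ (inj₁ refl)))
                                  | ∈subtree⁻ {u} {v} (subst (suc v ∈_) (sym eq) (∈subtree⁺ (inj₁ refl)))
  ... | inj₁ u≡v            | _                   = u≡v
  ... | inj₂ _              | inj₁ v≡u            = sym v≡u
  ... | inj₂ ((u≤v , _) , _) | inj₂ ((v≤u , _) , _) = ≤.antisym u≤v v≤u

  adjacent⇒meet : ∀ u v → u ≢ v → Adj G u v → Nonempty (subtree u ∩ subtree v)
  adjacent⇒meet u v u≢v u∼v with proj₁ lh u v u∼v
  ... | inj₁ u≤v = suc u , x∈p∩q⁺ (∈subtree⁺ (inj₁ refl) , ∈subtree⁺ (inj₂ ((u≤v , u≢v) , u∼v)))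
  ... | inj₂ v≤u = suc v , x∈p∩q⁺ (∈subtree⁺ (inj₂ ((v≤u , ≢-sym u≢v) , adj-sym u∼v)) , ∈subtree⁺ (inj₁ refl))

  -- a common lower neighbour x of u and v: u, v are comparable (tree order),
  -- and lefthandedness at x makes the larger one adjacent to the smaller
  meet⇒adjacent : ∀ u v x → u ≢ v → InSubtree u x → InSubtree v x → Adj G u v
  meet⇒adjacent u v x u≢v (inj₁ refl)      (inj₁ refl)      = ⊥-elim (u≢v refl)
  meet⇒adjacent u v x u≢v (inj₁ refl)      (inj₂ (_ , x∼v)) = x∼v
  meet⇒adjacent u v x u≢v (inj₂ (_ , x∼u)) (inj₁ refl)      = adj-sym x∼u
  meet⇒adjacent u v x u≢v (inj₂ (x<u , x∼u)) (inj₂ (x<v , x∼v))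
    with tree T (proj₁ x<u) (proj₂ x<u) (proj₁ x<v) (proj₂ x<v)
  ... | inj₁ u≤v = adj-sym (lefthanded x u v x<u (u≤v , u≢v) (adj-sym x∼v))
  ... | inj₂ v≤u = lefthanded x v u x<v (v≤u , ≢-sym u≢v) (adj-sym x∼u)

  adjacent⇔meet : ∀ u v → u ≢ v → (Adj G u v ⇔ Nonempty (subtree u ∩ subtree v))
  adjacent⇔meet u v u≢v = mk⇔ (adjacent⇒meet u v u≢v) meet
    where
    meet : Nonempty (subtree u ∩ subtree v) → Adj G u v
    meet (zero  , 0∈) = ⊥-elim (root∉subtree (proj₁ (x∈p∩q⁻ (subtree u) (subtree v) 0∈)))
    meet (suc x , x∈) = meet⇒adjacent u v x u≢v (∈subtree⁻ (proj₁ (x∈p∩q⁻ (subtree u) (subtree v) x∈)))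
                                                  (∈subtree⁻ (proj₂ (x∈p∩q⁻ (subtree u) (subtree v) x∈)))

  subtreeRepresentation : IsoToSubtreeGraph G
  subtreeRepresentation =
    suc n , Host , host-isTree , subtree , subtree-isSubtree , subtree-injective , adjacent⇔meet

module RootedTree {m : ℕ} (T : SimpleGraph m) (r : Fin m)
                  (connected : Connected T) (acyclic : ¬ HasCycle T) where

  sym-T : Symmetric (Adj T)
  sym-T = SimpleGraph.sym T

  anyWalk : ∀ x y → Walk (λ _ → Unit) (Adj T) x y
  anyWalk x y = weakenʷ (λ _ → tt) (fromWalkIn (connected x y))

  Avoiding : Fin m → Fin m → Set
  Avoiding a x = Walk (_≢ a) (Adj T) x r

  Ancestor : Fin m → Fin m → Set
  Ancestor a x = ¬ Avoiding a x

  avoiding? : ∀ a x → Dec (Avoiding a x)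
  avoiding? a x = DecidableWalks.walk? (λ z → ¬? (z FP.≟ a)) (dec T) x r

  ancestor? : ∀ a x → Dec (Ancestor a x)
  ancestor? a x = ¬? (avoiding? a x)

  nonAncestor⇒avoiding : ∀ {a x} → ¬ Ancestor a x → Avoiding a x
  nonAncestor⇒avoiding {a} {x} ¬a↑x with avoiding? a x
  ... | yes w  = w
  ... | no ¬w  = ⊥-elim (¬a↑x ¬w)

  ancestor-refl : ∀ {a} → Ancestor a a
  ancestor-refl w = start∈ w refl

  -- From its last visit of a, any walk to the root that passes a gives a walk
  -- from a to the root keeping the vertex property of the original walk.
  fromAncestor : ∀ {P : Fin m → Set} {a x} → Ancestor a x → Walk P (Adj T) x r → Walk P (Adj T) a r
  fromAncestor {a = a} a↑x W with lastVisit (FP._≟ a) W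
  ... | inj₁ W′                               = ⊥-elim (a↑x (weakenʷ proj₂ W′))
  ... | inj₂ (_ , refl , p , inj₁ refl)       = here p
  ... | inj₂ (_ , refl , p , inj₂ (_ , e , W′)) = step p e (weakenʷ proj₁ W′)

  ancestor-trans : ∀ {a b c} → Ancestor a b → Ancestor b c → Ancestor a c
  ancestor-trans a↑b b↑c W = a↑b (fromAncestor b↑c W)

  -- Leaving b for the last time on a walk to the root, a ≠ b must still lie
  -- ahead (a ↑ b); after the last visit of a neither a nor b occurs, so a
  -- reaches the root avoiding b, against b ↑ a.
  ancestor-antisym : ∀ {a b} → Ancestor a b → Ancestor b a → a ≡ b
  ancestor-antisym {a} {b} a↑b b↑a with a FP.≟ b
  ... | yes a≡b = a≡b
  ... | no  a≢b with lastVisit (FP._≟ b) (anyWalk b r)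
  ...   | inj₁ W = ⊥-elim (proj₂ (start∈ W) refl)
  ...   | inj₂ (_ , refl , _ , inj₁ refl) = ⊥-elim (a↑b (here (≢-sym a≢b)))
  ...   | inj₂ (_ , refl , _ , inj₂ (_ , e , W)) with lastVisit (FP._≟ a) W
  ...     | inj₁ W′ = ⊥-elim (a↑b (step (≢-sym a≢b) e (weakenʷ proj₂ W′)))
  ...     | inj₂ (_ , refl , p , inj₁ refl) = ⊥-elim (b↑a (here (proj₂ p)))
  ...     | inj₂ (_ , refl , p , inj₂ (_ , e′ , W′)) =
            ⊥-elim (b↑a (step (proj₂ p) e′ (weakenʷ (λ q → proj₂ (proj₁ q)) W′)))

  -- the ancestors of a vertex form a chain: on a walk from x to the root,
  -- whichever of a, b comes first has the other as an ancestor
  ancestor-total : ∀ {a b x} → Ancestor a x → Ancestor b x → Ancestor a b ⊎ Ancestor b a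
  ancestor-total {a} {b} {x} a↑x b↑x with a FP.≟ b
  ... | yes refl = inj₁ ancestor-refl
  ... | no  a≢b with firstVisit {Q = λ z → z ≡ a ⊎ z ≡ b} (λ z → (z FP.≟ a) ⊎-dec (z FP.≟ b)) (anyWalk x r)
  ...   | inj₁ W = ⊥-elim (a↑x (weakenʷ (λ q z≡a → proj₂ q (inj₁ z≡a)) W))
  ...   | inj₂ (_ , inj₁ refl , W) =
          inj₂ λ Wa → b↑x (weakenʷ (λ q z≡b → a≢b (trans (sym (proj₂ q (inj₂ z≡b))) z≡b)) W ++ʷ Wa)
  ...   | inj₂ (_ , inj₂ refl , W) =
          inj₁ λ Wb → a↑x (weakenʷ (λ q z≡a → a≢b (trans (sym z≡a) (proj₂ q (inj₁ z≡a)))) W ++ʷ Wb)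

  OtherEdge : Fin m → Fin m → Fin m → Fin m → Set
  OtherEdge a b x y = Adj T x y × ¬ ((x ≡ a × y ≡ b) ⊎ (x ≡ b × y ≡ a))

  -- every edge is a bridge: no other walk joins its ends, else a path
  -- between them closes a cycle with the edge
  bridge : ∀ {a b} → Adj T a b → ¬ Walk (λ _ → Unit) (OtherEdge a b) b a
  bridge {a} {b} a∼b W with LoopErasure.toPath FP._≟_ W
  ... | mkPath []                lk                    _  _ end = SimpleGraph.irrefl T (sym end) a∼b
  ... | mkPath (y ∷ [])          ((_ , ¬ab) ∷ _) _  _ end = ¬ab (inj₂ (refl , end))
  ... | mkPath (y ∷ z ∷ rest) lk                    un _ end =
        acyclic (b , y , z , rest , un ,
                 linked-snoc b (y ∷ z ∷ rest) b (Linked.map proj₁ lk) (subst (λ q → Adj T q b) (sym end) a∼b))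

  record Top (S : Subset m) : Set where
    field
      top          : Fin m
      top∈         : top ∈ S
      top-ancestor : ∀ y → y ∈ S → Ancestor top y

  -- Take the last vertex t of S on a walk from S to the root.  A walk from
  -- y ∈ S to the root avoiding t, together with a path inside S from t to y
  -- and the final leg from t's successor t′, joins t′ to t avoiding the edge tt′.
  topOf : ∀ {S} → IsSubtree T S → Top S
  topOf {S} ((x₀ , x₀∈) , S-connected) with lastVisit (_∈? S) (anyWalk x₀ r)
  ... | inj₁ W = ⊥-elim (proj₂ (start∈ W) x₀∈)
  ... | inj₂ (t , t∈ , _ , leg) = record { top = t ; top∈ = t∈ ; top-ancestor = λ y y∈ Wy → below y y∈ Wy leg }
    where
    below : ∀ y → y ∈ S → Avoiding t y → Exit {P = λ _ → Unit} {Q = _∈ S} {R = Adj T} (_∈? S) t r → ⊥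
    below y y∈ Wy (inj₁ t≡r) = end∈ Wy (sym t≡r)
    below y y∈ Wy (inj₂ (t′ , t∼t′ , Q)) = bridge t∼t′ (outside ++ʷ (back ++ʷ inside))
      where
      t′∉ : ¬ (t′ ∈ S)
      t′∉ = proj₂ (start∈ Q)
      outside = mapʷ (λ _ → tt)
        (λ px py e → e , λ { (inj₁ (x≡t , _)) → proj₂ px (subst (_∈ S) (sym x≡t) t∈)
                           ; (inj₂ (_ , y≡t)) → proj₂ py (subst (_∈ S) (sym y≡t) t∈) }) Q
      back = mapʷ (λ _ → tt)
        (λ px py e → e , λ { (inj₁ (x≡t , _)) → px x≡t ; (inj₂ (_ , y≡t)) → py y≡t }) (reverseʷ sym-T Wy)
      inside = mapʷ (λ _ → tt)
        (λ px py e → e , λ { (inj₁ (_ , y≡t′)) → t′∉ (subst (_∈ S) y≡t′ py)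
                           ; (inj₂ (x≡t′ , _)) → t′∉ (subst (_∈ S) x≡t′ px) })
        (reverseʷ sym-T (fromWalkIn (S-connected t y t∈ y∈)))

  -- subtrees are convex: an ancestor a of y ∈ S below the top of S lies in S
  -- (otherwise y reaches the root avoiding a through S and the top)
  convex : ∀ {S} → ConnectedSet T S → (τ : Top S) → ∀ {a y} →
           y ∈ S → Ancestor a y → Ancestor (Top.top τ) a → a ∈ S
  convex {S} S-connected τ {a} {y} y∈ a↑y top↑a with a ∈? S
  ... | yes a∈ = a∈
  ... | no  a∉ = ⊥-elim (a↑y (toTop ++ʷ nonAncestor⇒avoiding ¬a↑top))
    where
    open Top τ
    ¬a↑top : ¬ Ancestor a top
    ¬a↑top a↑top = a∉ (subst (_∈ S) (sym (ancestor-antisym a↑top top↑a)) top∈)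
    toTop : Walk (_≢ a) (Adj T) y top
    toTop = weakenʷ (λ z∈ z≡a → a∉ (subst (_∈ S) z≡a z∈)) (fromWalkIn (S-connected y top y∈ top∈))

module FromSubtrees {n m : ℕ} (G : SimpleGraph n) (T : SimpleGraph m) (r : Fin m)
                    (connected : Connected T) (acyclic : ¬ HasCycle T)
                    (f : Fin n → Subset m) (subtrees : ∀ i → IsSubtree T (f i))
                    (meet⇔adjacent : ∀ u v → u ≢ v → (Adj G u v ⇔ Nonempty (f u ∩ f v))) where

  open RootedTree T r connected acyclic

  top : Fin n → Fin m
  top i = Top.top (topOf (subtrees i))

  top∈ : ∀ i → top i ∈ f i
  top∈ i = Top.top∈ (topOf (subtrees i))

  top-ancestor : ∀ i y → y ∈ f i → Ancestor (top i) y
  top-ancestor i = Top.top-ancestor (topOf (subtrees i))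

  convex-f : ∀ v {a y} → y ∈ f v → Ancestor a y → Ancestor (top v) a → a ∈ f v
  convex-f v = convex (proj₂ (subtrees v)) (topOf (subtrees v))

  _≺_ : Fin n → Fin n → Set
  u ≺ v = (Ancestor (top v) (top u) × top v ≢ top u) ⊎ (top u ≡ top v × u F.< v)

  _≼_ : Fin n → Fin n → Set
  u ≼ v = u ≡ v ⊎ u ≺ v

  ≺⇒ancestor : ∀ {u v} → u ≺ v → Ancestor (top v) (top u)
  ≺⇒ancestor (inj₁ (anc , _)) = anc
  ≺⇒ancestor (inj₂ (eq , _))  = subst (λ q → Ancestor q _) eq ancestor-refl

  ≺-trans : ∀ {u v w} → u ≺ v → v ≺ w → u ≺ w
  ≺-trans {u} {v} {w} (inj₁ (a₁ , n₁)) (inj₁ (a₂ , n₂)) =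
    inj₁ (ancestor-trans a₂ a₁ , λ eq → n₁ (ancestor-antisym a₁ (subst (λ q → Ancestor q (top v)) eq a₂)))
  ≺-trans (inj₁ (a₁ , n₁)) (inj₂ (e₂ , _))  = inj₁ (subst (λ q → Ancestor q _) e₂ a₁ , λ eq → n₁ (trans e₂ eq))
  ≺-trans (inj₂ (e₁ , _))  (inj₁ (a₂ , n₂)) = inj₁ (subst (Ancestor _) (sym e₁) a₂ , λ eq → n₂ (trans eq e₁))
  ≺-trans (inj₂ (e₁ , l₁)) (inj₂ (e₂ , l₂)) = inj₂ (trans e₁ e₂ , FP.<-trans l₁ l₂)

  ≼-trans : ∀ {u v w} → u ≼ v → v ≼ w → u ≼ w
  ≼-trans (inj₁ refl) q           = q
  ≼-trans p           (inj₁ refl) = p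
  ≼-trans (inj₂ p)    (inj₂ q)    = inj₂ (≺-trans p q)

  ≼-antisym : ∀ {u v} → u ≼ v → v ≼ u → u ≡ v
  ≼-antisym (inj₁ eq) _ = eq
  ≼-antisym (inj₂ _)  (inj₁ eq) = sym eq
  ≼-antisym (inj₂ (inj₁ (a₁ , n₁))) (inj₂ (inj₁ (a₂ , _))) = ⊥-elim (n₁ (ancestor-antisym a₁ a₂))
  ≼-antisym (inj₂ (inj₁ (_ , n₁)))  (inj₂ (inj₂ (eq , _))) = ⊥-elim (n₁ eq)
  ≼-antisym (inj₂ (inj₂ (eq , _)))  (inj₂ (inj₁ (_ , n₂))) = ⊥-elim (n₂ eq)
  ≼-antisym (inj₂ (inj₂ (_ , l₁)))  (inj₂ (inj₂ (_ , l₂))) = ⊥-elim (FP.<-asym l₁ l₂)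

  strict : ∀ {u v} → u ≼ v → u ≢ v → u ≺ v
  strict (inj₁ eq) u≢v = ⊥-elim (u≢v eq)
  strict (inj₂ u≺v) _  = u≺v

  comparable : ∀ u v → Ancestor (top v) (top u) ⊎ Ancestor (top u) (top v) → u ≼ v ⊎ v ≼ u
  comparable u v tops with top v FP.≟ top u | tops
  ... | no  ne | inj₁ v↑u = inj₁ (inj₂ (inj₁ (v↑u , ne)))
  ... | no  ne | inj₂ u↑v = inj₂ (inj₂ (inj₁ (u↑v , ≢-sym ne)))
  ... | yes eq | _ with FP.<-cmp u v
  ...   | tri< u<v _ _ = inj₁ (inj₂ (inj₂ (sym eq , u<v)))
  ...   | tri≈ _ u≡v _ = inj₁ (inj₁ u≡v)
  ...   | tri> _ _ v<u = inj₂ (inj₂ (inj₂ (eq , v<u)))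

  order : TreeOrder n
  order = record
    { _≤ₜ_           = _≼_
    ; isPartialOrder = record
        { isPreorder = record { isEquivalence = isEquivalence ; reflexive = inj₁ ; trans = ≼-trans }
        ; antisym    = ≼-antisym }
    ; dec  = λ u v → (u FP.≟ v) ⊎-dec ((ancestor? (top v) (top u) ×-dec ¬? (top v FP.≟ top u))
                                       ⊎-dec ((top u FP.≟ top v) ×-dec (u FP.<? v)))
    -- two elements above w have tops that are ancestors of the top of w
    ; tree = λ {w} {u} {v} w≼u w≢u w≼v w≢v →
        comparable u v (ancestor-total (≺⇒ancestor (strict w≼v w≢v)) (≺⇒ancestor (strict w≼u w≢u)))
    }

  -- adjacent vertices have meeting subtrees, so their tops lie on the
  -- common ancestor chain of a shared vertex
  adjacent⇒comparable : ∀ u v → Adj G u v → u ≼ v ⊎ v ≼ u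
  adjacent⇒comparable u v u∼v with u FP.≟ v
  ... | yes refl = ⊥-elim (SimpleGraph.irrefl G refl u∼v)
  ... | no  u≢v with Equivalence.to (meet⇔adjacent u v u≢v) u∼v
  ...   | x , x∈ = comparable u v (ancestor-total (top-ancestor v x (proj₂ (x∈p∩q⁻ (f u) (f v) x∈)))
                                                  (top-ancestor u x (proj₁ (x∈p∩q⁻ (f u) (f v) x∈))))

  -- w ≺ u ≺ v and v ∼ w: convexity of f v puts first top w, then top u into
  -- f v, so f u and f v meet at top u
  lefthanded : ∀ w u v → w <[ order ] u → u <[ order ] v → Adj G v w → Adj G v u
  lefthanded w u v (w≼u , w≢u) (u≼v , u≢v) v∼w with Equivalence.to (meet⇔adjacent v w v≢w) v∼w
    where v≢w = λ eq → SimpleGraph.irrefl G eq v∼w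
  ... | x , x∈ = Equivalence.from (meet⇔adjacent v u (≢-sym u≢v)) (top u , x∈p∩q⁺ (topu∈fv , top∈ u))
    where
    u↑w = ≺⇒ancestor (strict w≼u w≢u)
    v↑u = ≺⇒ancestor (strict u≼v u≢v)
    topw∈fv = convex-f v (proj₁ (x∈p∩q⁻ (f v) (f w) x∈))
                         (top-ancestor w x (proj₂ (x∈p∩q⁻ (f v) (f w) x∈))) (ancestor-trans v↑u u↑w)
    topu∈fv = convex-f v topw∈fv u↑w v↑u

  isLefthanded : Lefthanded G order
  isLefthanded = adjacent⇒comparable , lefthanded

-- the host tree is nonempty, so it has a vertex to serve as root
treeOrderFromSubtrees : ∀ {n} (G : SimpleGraph n) → IsoToSubtreeGraph G → Σ (TreeOrder n) (Lefthanded G)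
treeOrderFromSubtrees G (suc m , T , (_ , connected , acyclic) , f , subtrees , _ , meet⇔adjacent) =
  order , isLefthanded
  where open FromSubtrees G T zero connected acyclic f subtrees meet⇔adjacent

mainTheorem2 : ∀ {n : ℕ} (G : SimpleGraph n) →
    (Σ (TreeOrder n) (λ T → Lefthanded G T)) ⇔ IsoToSubtreeGraph G
mainTheorem2 G = mk⇔ (λ { (T , lh) → FromTreeOrder.subtreeRepresentation G T lh })
                     (treeOrderFromSubtrees G)
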